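{- Let $\mathcal{C}(\widetilde{D}_4)$ be the point-line incidence structure with points $0,1,2,3,4$ and lines $\{0,2\},\{1,2\},\{2,3\},\{2,4\}$. Then $\mathcal{C}(\widetilde{D}_4)$ has exactly $16$ geometric hyperplanes and exactly $35$ three-point Veldkamp lines. The $15$ geometric hyperplanes containing the point $2$, together with these $35$ lines, form an incidence structure isomorphic to $\mathrm{PG}(3,2)$. The remaining hyperplane $\{0,1,3,4\}$ lies on no three-point Veldkamp line.
   Context: A geometric hyperplane of a point-line incidence structure is a proper subset $H$ of the point set such that every line is either contained in $H$ or meets $H$ in exactly one point. A three-point Veldkamp line is a set $\{H_1,H_2,H_3\}$ of three distinct geometric hyperplanes such that $H_3$ is the complement, in the point set, of the symmetric difference $H_1 \triangle H_2$. $\mathrm{PG}(3,2)$ is the $3$-dimensional projective space over $\mathrm{GF}(2)$. -}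

module Defs where

open import Data.Bool using (Bool; true; false; _xor_)
open import Data.Nat using (ℕ)
open import Data.Fin using (Fin; #_)
open import Data.Fin.Subset using (Subset; _∈_; _⊂_; ⊤; ∁; _∪_; _─_)
open import Data.List using (List; []; _∷_; length)
open import Data.List.Membership.Propositional using () renaming (_∈_ to _∈ₗ_)
open import Data.List.Relation.Unary.All using (All)
open import Data.List.Relation.Unary.Any using (Any)
open import Data.List.Relation.Unary.AllPairs using (AllPairs)
open import Data.List.Relation.Unary.Unique.Propositional using (Unique)
open import Data.Vec using (Vec; zipWith; replicate)
open import Data.Product using (Σ; ∃; ∃-syntax; _×_; _,_)
open import Data.Sum using (_⊎_)
open import Relation.Nullary using (¬_)
open import Relation.Binary.PropositionalEquality using (_≡_; _≢_)
open import Function.Bundles using (_⇔_)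

IncStr : ℕ → Set
IncStr n = List (List (Fin n))

IsHyperplane : ∀ {n} → IncStr n → Subset n → Set
IsHyperplane {n} S H =
  H ⊂ ⊤ ×
  (∀ (L : List (Fin n)) → L ∈ₗ S →
     (∀ x → x ∈ₗ L → x ∈ H)
     ⊎ (∃[ x ] (x ∈ₗ L × x ∈ H × (∀ y → y ∈ₗ L → y ∈ H → y ≡ x))))

_△_ : ∀ {n} → Subset n → Subset n → Subset n
p △ q = (p ─ q) ∪ (q ─ p)

IsVeldkampLine : ∀ {n} → IncStr n → Subset n → Subset n → Subset n → Set
IsVeldkampLine S H₁ H₂ H₃ =
  IsHyperplane S H₁ × IsHyperplane S H₂ × IsHyperplane S H₃ ×
  H₁ ≢ H₂ × H₁ ≢ H₃ × H₂ ≢ H₃ ×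
  H₃ ≡ ∁ (H₁ △ H₂)

-- Triples, regarded as (unordered) sets {a,b,c}.
Triple : Set → Set
Triple A = A × A × A

_∈₃_ : ∀ {A : Set} → A → Triple A → Set
x ∈₃ (a , b , c) = x ≡ a ⊎ x ≡ b ⊎ x ≡ c

SameSet : ∀ {A : Set} → Triple A → Triple A → Set
SameSet {A} t t' = ∀ (x : A) → (x ∈₃ t) ⇔ (x ∈₃ t')

IsVeldkampLine₃ : ∀ {n} → IncStr n → Triple (Subset n) → Set
IsVeldkampLine₃ S (a , b , c) = IsVeldkampLine S a b c

-- "The type of X's has exactly k elements", for a predicate P on a type with
-- propositional equality: a duplicate-free list of length k enumerating them.
HasExactly : ∀ {A : Set} → ℕ → (A → Set) → Set
HasExactly {A} k P =
  Σ (List A) λ xs → length xs ≡ k × Unique xs × All P xs × (∀ x → P x → x ∈ₗ xs)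

-- Same, counting unordered triples (sets of size 3) up to set equality.
HasExactlyTriples : ∀ {A : Set} → ℕ → (Triple A → Set) → Set
HasExactlyTriples {A} k P =
  Σ (List (Triple A)) λ ts → length ts ≡ k × AllPairs (λ t t' → ¬ SameSet t t') ts ×
    All P ts × (∀ t → P t → Any (SameSet t) ts)

-- PG(3,2): points are the nonzero vectors of GF(2)^4 (GF(2) = Bool with xor),
-- lines are the sets {u, v, u + v} for distinct points u, v.
GF2⁴ : Set
GF2⁴ = Vec Bool 4

0ᵥ : GF2⁴
0ᵥ = replicate 4 false

_+ᵥ_ : GF2⁴ → GF2⁴ → GF2⁴
_+ᵥ_ = zipWith _xor_

IsPGPoint : GF2⁴ → Set
IsPGPoint v = v ≢ 0ᵥ

IsPGLine : GF2⁴ → GF2⁴ → GF2⁴ → Set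
IsPGLine u v w = IsPGPoint u × IsPGPoint v × u ≢ v × w ≡ u +ᵥ v

CD4 : IncStr 5
CD4 = (# 0 ∷ # 2 ∷ []) ∷ (# 1 ∷ # 2 ∷ []) ∷ (# 2 ∷ # 3 ∷ []) ∷ (# 2 ∷ # 4 ∷ []) ∷ []

H0134 : Subset 5
H0134 = true Data.Vec.∷ true Data.Vec.∷ false Data.Vec.∷ true Data.Vec.∷ true Data.Vec.∷ Data.Vec.[]

-- Each line of C(D̃₄) consists of the point 2 and one of the outer points
-- 0, 1, 3, 4, so the hyperplanes are {0,1,3,4} and the proper subsets that
-- contain 2.  A hyperplane H through 2 is recorded by the outer points it
-- misses, a nonzero vector of GF(2)⁴; since ∁ (H₁ △ H₂) is pointwise
-- "H₁ and H₂ agree", this coordinatisation turns the third point of a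
-- Veldkamp line into the sum u + v, so Veldkamp lines through 2 are exactly
-- the lines of PG(3,2).  The point 2 lies in an even number of the members
-- of any Veldkamp line and {0,1,3,4} is the only hyperplane avoiding it,
-- which keeps {0,1,3,4} off every line.  The two counts are finite checks.

module Submission where

open import Defs
open import Data.Bool using (Bool; true; false; not; _xor_)
open import Data.Bool.Properties using (not-involutive; xor-annihilates-not; xor-comm) renaming (_≟_ to _≟ᵇ_)
open import Data.Empty using (⊥-elim)
open import Data.Fin using (Fin; #_) renaming (_≟_ to _≟ᶠ_)
open import Data.Fin.Subset using (Subset; _∈_; _∉_; _⊂_; ⊤; ∁; _─_)
open import Data.Fin.Subset.Properties using (_∈?_; _⊂?_; ∪-comm; ∈⊤)
open import Data.List using (List; []; _∷_; _++_; map; filter; deduplicate; cartesianProduct)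
open import Data.List.Membership.Propositional using (find; lose) renaming (_∈_ to _∈ₗ_)
open import Data.List.Membership.Propositional.Properties
  using (∈-++⁺ˡ; ∈-++⁺ʳ; ∈-map⁺; ∈-filter⁺; ∈-cartesianProduct⁺)
open import Data.List.Relation.Unary.All as All using (all?)
import Data.List.Relation.Unary.All.Properties as All
open import Data.List.Relation.Unary.Any using (here; any?)
import Data.List.Relation.Unary.Any.Properties as Any
import Data.List.Relation.Unary.Unique.DecPropositional as UniqueDec
open import Data.List.Relation.Unary.Unique.DecSetoid.Properties using (deduplicate-!)
open import Data.Nat using (zero; suc)
open import Data.Product using (Σ; ∃-syntax; _×_; _,_; proj₁; proj₂)
open import Data.Sum using (inj₁; inj₂; _⊎_)
open import Data.Vec using (Vec; []; _∷_; zipWith; replicate; here; there)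
open import Data.Vec.Properties using (≡-dec; ∷-injective; zipWith-comm)
open import Function using (_∘_)
open import Function.Bundles using (_⇔_; mk⇔; Equivalence)
import Function.Properties.Equivalence as ⇔
open import Relation.Binary using (DecidableEquality; IsEquivalence; DecSetoid)
open import Relation.Binary.PropositionalEquality
  using (_≡_; _≢_; refl; sym; trans; cong; cong₂; subst; module ≡-Reasoning)
open import Relation.Nullary using (¬_; Dec; yes; no; ¬?; _×-dec_; _⊎-dec_; _→-dec_; toWitness)
open import Relation.Nullary.Decidable using (map′)
open import Relation.Unary using (Decidable)

open ≡-Reasoning

subsets : ∀ n → List (Subset n)
subsets zero = [] ∷ []
subsets (suc n) = map (false ∷_) (subsets n) ++ map (true ∷_) (subsets n)

∈-subsets : ∀ {n} (p : Subset n) → p ∈ₗ subsets n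
∈-subsets [] = here refl
∈-subsets (false ∷ p) = ∈-++⁺ˡ (∈-map⁺ (false ∷_) (∈-subsets p))
∈-subsets (true ∷ p) = ∈-++⁺ʳ _ (∈-map⁺ (true ∷_) (∈-subsets p))

all-subsets? : ∀ {n} {P : Subset n → Set} → Decidable P → Dec (∀ p → P p)
all-subsets? P? = map′ (λ all p → All.lookup all (∈-subsets p)) (λ ∀P → All.tabulate (λ {p} _ → ∀P p))
  (all? P? (subsets _))

module _ {A : Set} {P : A → Set} (P? : Decidable P) where

  all-∈? : (xs : List A) → Dec (∀ x → x ∈ₗ xs → P x)
  all-∈? xs = map′ (λ all x → All.lookup all) (λ ∀P → All.tabulate (λ {x} → ∀P x)) (all? P? xs)

  any-∈? : (xs : List A) → Dec (∃[ x ] (x ∈ₗ xs × P x))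
  any-∈? xs = map′ find (λ (x , x∈xs , px) → lose x∈xs px) (any? P? xs)

_≟ˢ_ : ∀ {n} → DecidableEquality (Subset n)
_≟ˢ_ = ≡-dec _≟ᵇ_

isHyperplane? : ∀ {n} (S : IncStr n) → Decidable (IsHyperplane S)
isHyperplane? S H = (H ⊂? ⊤) ×-dec all-∈? meetsProperly? S
  where
  meetsProperly? : ∀ L → Dec ((∀ x → x ∈ₗ L → x ∈ H)
                              ⊎ (∃[ x ] (x ∈ₗ L × x ∈ H × (∀ y → y ∈ₗ L → y ∈ H → y ≡ x))))
  meetsProperly? L = all-∈? (_∈? H) L
    ⊎-dec any-∈? (λ x → (x ∈? H) ×-dec all-∈? (λ y → (y ∈? H) →-dec (y ≟ᶠ x)) L) L

isVeldkampLine? : ∀ {n} (S : IncStr n) H₁ H₂ H₃ → Dec (IsVeldkampLine S H₁ H₂ H₃)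
isVeldkampLine? S H₁ H₂ H₃ =
  isHyperplane? S H₁ ×-dec isHyperplane? S H₂ ×-dec isHyperplane? S H₃ ×-dec
  ¬? (H₁ ≟ˢ H₂) ×-dec ¬? (H₁ ≟ˢ H₃) ×-dec ¬? (H₂ ≟ˢ H₃) ×-dec H₃ ≟ˢ ∁ (H₁ △ H₂)

sameSet-isEquivalence : ∀ {A : Set} → IsEquivalence (SameSet {A})
sameSet-isEquivalence = record
  { refl = λ x → ⇔.refl
  ; sym = λ t≈t' x → ⇔.sym (t≈t' x)
  ; trans = λ t≈t' t'≈t'' x → ⇔.trans (t≈t' x) (t'≈t'' x)
  }

module _ {A : Set} (_≟_ : DecidableEquality A) where

  _∈₃?_ : ∀ x (t : Triple A) → Dec (x ∈₃ t)
  x ∈₃? (a , b , c) = x ≟ a ⊎-dec x ≟ b ⊎-dec x ≟ c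

  ⊆₃? : ∀ t t' → Dec (∀ x → x ∈₃ t → x ∈₃ t')
  ⊆₃? (a , b , c) t' = map′
    (λ { (a∈ , b∈ , c∈) x (inj₁ refl) → a∈ ; (a∈ , b∈ , c∈) x (inj₂ (inj₁ refl)) → b∈
       ; (a∈ , b∈ , c∈) x (inj₂ (inj₂ refl)) → c∈ })
    (λ t⊆t' → t⊆t' a (inj₁ refl) , t⊆t' b (inj₂ (inj₁ refl)) , t⊆t' c (inj₂ (inj₂ refl)))
    (a ∈₃? t' ×-dec b ∈₃? t' ×-dec c ∈₃? t')

  sameSet? : ∀ t t' → Dec (SameSet t t')
  sameSet? t t' = map′ (λ (t⊆t' , t'⊆t) x → mk⇔ (t⊆t' x) (t'⊆t x))
    (λ t≈t' → (λ x → Equivalence.to (t≈t' x)) , (λ x → Equivalence.from (t≈t' x)))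
    (⊆₃? t t' ×-dec ⊆₃? t' t)

  sameSet-decSetoid : DecSetoid _ _
  sameSet-decSetoid = record
    { Carrier = Triple A
    ; _≈_ = SameSet
    ; isDecEquivalence = record { isEquivalence = sameSet-isEquivalence ; _≟_ = sameSet? }
    }

△-xor : ∀ {n} (p q : Subset n) → p △ q ≡ zipWith _xor_ p q
△-xor [] [] = refl
△-xor (false ∷ p) (false ∷ q) = cong (false ∷_) (△-xor p q)
△-xor (false ∷ p) (true ∷ q) = cong (true ∷_) (△-xor p q)
△-xor (true ∷ p) (false ∷ q) = cong (true ∷_) (△-xor p q)
△-xor (true ∷ p) (true ∷ q) = cong (false ∷_) (△-xor p q)

△-comm : ∀ {n} (p q : Subset n) → p △ q ≡ q △ p
△-comm p q = ∪-comm (p ─ q) (q ─ p)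

∈∁△⁺ : ∀ {n} {x : Fin n} {p q} → x ∈ p → x ∈ q → x ∈ ∁ (p △ q)
∈∁△⁺ here here = here
∈∁△⁺ (there x∈p) (there x∈q) = there (∈∁△⁺ x∈p x∈q)

∈∁△-∈ʳ : ∀ {n} {x : Fin n} {p q} → x ∈ ∁ (p △ q) → x ∈ p → x ∈ q
∈∁△-∈ʳ {q = true ∷ _} here here = here
∈∁△-∈ʳ {q = false ∷ _} () here
∈∁△-∈ʳ {q = _ ∷ _} (there x∈) (there x∈p) = there (∈∁△-∈ʳ x∈ x∈p)

∈∁△-∈ˡ : ∀ {n} {x : Fin n} {p q} → x ∈ ∁ (p △ q) → x ∈ q → x ∈ p
∈∁△-∈ˡ {p = p} {q} x∈ = ∈∁△-∈ʳ (subst (λ r → _ ∈ ∁ r) (△-comm p q) x∈)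

xor-cancelˡ : ∀ {n} (u v : Vec Bool n) → u ≡ zipWith _xor_ u v → v ≡ replicate n false
xor-cancelˡ [] [] _ = refl
xor-cancelˡ (x ∷ u) (y ∷ v) eq with ∷-injective eq
... | x≡x+y , u≡u+v = cong₂ _∷_ (bit x y x≡x+y) (xor-cancelˡ u v u≡u+v)
  where
  bit : ∀ x y → x ≡ x xor y → y ≡ false
  bit false false _ = refl
  bit true false _ = refl

xor-cancelʳ : ∀ {n} (u v : Vec Bool n) → v ≡ zipWith _xor_ u v → u ≡ replicate n false
xor-cancelʳ u v eq = xor-cancelˡ v u (trans eq (zipWith-comm xor-comm u v))

hyperplanes : List (Subset 5)
hyperplanes = filter (isHyperplane? CD4) (subsets 5)

∈-hyperplanes : ∀ {H} → IsHyperplane CD4 H → H ∈ₗ hyperplanes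
∈-hyperplanes {H} = ∈-filter⁺ (isHyperplane? CD4) (∈-subsets H)

hyperplanes-count : HasExactly 16 (IsHyperplane CD4)
hyperplanes-count = hyperplanes , refl , toWitness {a? = UniqueDec.unique? _≟ˢ_ hyperplanes} _ ,
  All.all-filter (isHyperplane? CD4) (subsets 5) , λ H → ∈-hyperplanes

lineThrough : ∀ {n} → Subset n × Subset n → Triple (Subset n)
lineThrough (H₁ , H₂) = H₁ , H₂ , ∁ (H₁ △ H₂)

isVeldkampLine₃? : ∀ {n} (S : IncStr n) → Decidable (IsVeldkampLine₃ S)
isVeldkampLine₃? S (H₁ , H₂ , H₃) = isVeldkampLine? S H₁ H₂ H₃

orderedVeldkampLines : List (Triple (Subset 5))
orderedVeldkampLines =
  filter (isVeldkampLine₃? CD4) (map lineThrough (cartesianProduct hyperplanes hyperplanes))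

∈-orderedVeldkampLines : ∀ {t} → IsVeldkampLine₃ CD4 t → t ∈ₗ orderedVeldkampLines
∈-orderedVeldkampLines line@(isH₁ , isH₂ , _ , _ , _ , _ , refl) =
  ∈-filter⁺ (isVeldkampLine₃? CD4)
    (∈-map⁺ lineThrough (∈-cartesianProduct⁺ (∈-hyperplanes isH₁) (∈-hyperplanes isH₂))) line

veldkampLines : List (Triple (Subset 5))
veldkampLines = deduplicate (sameSet? _≟ˢ_) orderedVeldkampLines

veldkampLines-count : HasExactlyTriples 35 (IsVeldkampLine₃ CD4)
veldkampLines-count = veldkampLines , refl , deduplicate-! (sameSet-decSetoid _≟ˢ_) orderedVeldkampLines ,
  All.deduplicate⁺ (sameSet? _≟ˢ_) (All.all-filter (isVeldkampLine₃? CD4) orderedVeldkampLines) ,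
  λ t line → Any.deduplicate⁺ (sameSet? _≟ˢ_) (λ t'≈t'' t≈t' → ≈-trans t≈t' (≈-sym t'≈t''))
               (lose (∈-orderedVeldkampLines line) ≈-refl)
  where
  open IsEquivalence (sameSet-isEquivalence {Subset 5}) using ()
    renaming (refl to ≈-refl; sym to ≈-sym; trans to ≈-trans)

coordinates : Subset 5 → GF2⁴
coordinates (h₀ ∷ h₁ ∷ _ ∷ h₃ ∷ h₄ ∷ []) = not h₀ ∷ not h₁ ∷ not h₃ ∷ not h₄ ∷ []

hyperplaneAt : GF2⁴ → Subset 5
hyperplaneAt (v₀ ∷ v₁ ∷ v₃ ∷ v₄ ∷ []) = not v₀ ∷ not v₁ ∷ true ∷ not v₃ ∷ not v₄ ∷ []

2∈hyperplaneAt : ∀ v → # 2 ∈ hyperplaneAt v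
2∈hyperplaneAt (_ ∷ _ ∷ _ ∷ _ ∷ []) = there (there here)

coordinates-hyperplaneAt : ∀ v → coordinates (hyperplaneAt v) ≡ v
coordinates-hyperplaneAt (v₀ ∷ v₁ ∷ v₃ ∷ v₄ ∷ [])
  rewrite not-involutive v₀ | not-involutive v₁ | not-involutive v₃ | not-involutive v₄ = refl

hyperplaneAt-coordinates : ∀ {H} → # 2 ∈ H → hyperplaneAt (coordinates H) ≡ H
hyperplaneAt-coordinates {h₀ ∷ h₁ ∷ true ∷ h₃ ∷ h₄ ∷ []} (there (there here))
  rewrite not-involutive h₀ | not-involutive h₁ | not-involutive h₃ | not-involutive h₄ = refl

coordinates-injective : ∀ {H H'} → # 2 ∈ H → # 2 ∈ H' → coordinates H ≡ coordinates H' → H ≡ H'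
coordinates-injective {H} {H'} 2∈H 2∈H' eq = begin
  H                           ≡⟨ hyperplaneAt-coordinates 2∈H ⟨
  hyperplaneAt (coordinates H)  ≡⟨ cong hyperplaneAt eq ⟩
  hyperplaneAt (coordinates H') ≡⟨ hyperplaneAt-coordinates 2∈H' ⟩
  H'                          ∎

coordinates-∁△ : ∀ H₁ H₂ → coordinates (∁ (H₁ △ H₂)) ≡ coordinates H₁ +ᵥ coordinates H₂
coordinates-∁△ H₁ H₂ = trans (cong (coordinates ∘ ∁) (△-xor H₁ H₂)) (coordinates-∁-xor H₁ H₂)
  where
  bit : ∀ x y → not (not (x xor y)) ≡ not x xor not y
  bit x y = trans (not-involutive (x xor y)) (sym (xor-annihilates-not x y))
  coordinates-∁-xor : ∀ H₁ H₂ → coordinates (∁ (zipWith _xor_ H₁ H₂)) ≡ coordinates H₁ +ᵥ coordinates H₂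
  coordinates-∁-xor (a₀ ∷ a₁ ∷ _ ∷ a₃ ∷ a₄ ∷ []) (b₀ ∷ b₁ ∷ _ ∷ b₃ ∷ b₄ ∷ [])
    rewrite bit a₀ b₀ | bit a₁ b₁ | bit a₃ b₃ | bit a₄ b₄ = refl

proper⇒≢⊤ : ∀ {n} {H : Subset n} → H ⊂ ⊤ → H ≢ ⊤
proper⇒≢⊤ (_ , x , _ , x∉H) refl = x∉H ∈⊤

coordinates-nonzero : ∀ {H} → IsHyperplane CD4 H → # 2 ∈ H → IsPGPoint (coordinates H)
coordinates-nonzero (H⊂⊤ , _) 2∈H c≡0 =
  proper⇒≢⊤ H⊂⊤ (trans (sym (hyperplaneAt-coordinates 2∈H)) (cong hyperplaneAt c≡0))

hyperplaneAt-isHyperplane : ∀ v → IsPGPoint v → IsHyperplane CD4 (hyperplaneAt v)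
hyperplaneAt-isHyperplane = toWitness {a? = all-subsets? λ v → ¬? (v ≟ˢ 0ᵥ) →-dec isHyperplane? CD4 (hyperplaneAt v)} _

H0134-isHyperplane : IsHyperplane CD4 H0134
H0134-isHyperplane = toWitness {a? = isHyperplane? CD4 H0134} _

2∉H0134 : # 2 ∉ H0134
2∉H0134 (there (there ()))

avoids-2⇒H0134 : ∀ H → IsHyperplane CD4 H → # 2 ∉ H → H ≡ H0134
avoids-2⇒H0134 = toWitness {a? = all-subsets? λ H → isHyperplane? CD4 H →-dec ¬? (# 2 ∈? H) →-dec H ≟ˢ H0134} _

avoids-2-unique : ∀ {H H'} → IsHyperplane CD4 H → # 2 ∉ H → IsHyperplane CD4 H' → # 2 ∉ H' → H ≡ H'
avoids-2-unique {H} {H'} isH 2∉H isH' 2∉H' =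
  trans (avoids-2⇒H0134 H isH 2∉H) (sym (avoids-2⇒H0134 H' isH' 2∉H'))

veldkampLine-through-2 : ∀ {H₁ H₂ H₃} → IsVeldkampLine CD4 H₁ H₂ H₃ → # 2 ∈ H₁ × # 2 ∈ H₂ × # 2 ∈ H₃
veldkampLine-through-2 {H₁} {H₂} (isH₁ , isH₂ , isH₃ , H₁≢H₂ , H₁≢H₃ , H₂≢H₃ , refl)
  with # 2 ∈? H₁ | # 2 ∈? H₂
... | yes 2∈H₁ | yes 2∈H₂ = 2∈H₁ , 2∈H₂ , ∈∁△⁺ 2∈H₁ 2∈H₂
... | no 2∉H₁  | no 2∉H₂  = ⊥-elim (H₁≢H₂ (avoids-2-unique isH₁ 2∉H₁ isH₂ 2∉H₂))
... | no 2∉H₁  | yes 2∈H₂ =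
  ⊥-elim (H₁≢H₃ (avoids-2-unique isH₁ 2∉H₁ isH₃ (λ 2∈H₃ → 2∉H₁ (∈∁△-∈ˡ 2∈H₃ 2∈H₂))))
... | yes 2∈H₁ | no 2∉H₂  =
  ⊥-elim (H₂≢H₃ (avoids-2-unique isH₂ 2∉H₂ isH₃ (λ 2∈H₃ → 2∉H₂ (∈∁△-∈ʳ 2∈H₃ 2∈H₁))))

veldkampLine-avoids-H0134 : ∀ {H₁ H₂ H₃} → IsVeldkampLine CD4 H₁ H₂ H₃ → ¬ (H0134 ∈₃ (H₁ , H₂ , H₃))
veldkampLine-avoids-H0134 line (inj₁ refl) = 2∉H0134 (proj₁ (veldkampLine-through-2 line))
veldkampLine-avoids-H0134 line (inj₂ (inj₁ refl)) = 2∉H0134 (proj₁ (proj₂ (veldkampLine-through-2 line)))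
veldkampLine-avoids-H0134 line (inj₂ (inj₂ refl)) = 2∉H0134 (proj₂ (proj₂ (veldkampLine-through-2 line)))

veldkampLine⇔pgLine : ∀ {H₁ H₂ H₃} → IsHyperplane CD4 H₁ → # 2 ∈ H₁ → IsHyperplane CD4 H₂ → # 2 ∈ H₂ →
  IsHyperplane CD4 H₃ → # 2 ∈ H₃ →
  IsVeldkampLine CD4 H₁ H₂ H₃ ⇔ IsPGLine (coordinates H₁) (coordinates H₂) (coordinates H₃)
veldkampLine⇔pgLine {H₁} {H₂} {H₃} isH₁ 2∈H₁ isH₂ 2∈H₂ isH₃ 2∈H₃ = mk⇔ toPG fromPG
  where
  toPG : IsVeldkampLine CD4 H₁ H₂ H₃ → IsPGLine (coordinates H₁) (coordinates H₂) (coordinates H₃)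
  toPG (_ , _ , _ , H₁≢H₂ , _ , _ , refl) =
    coordinates-nonzero isH₁ 2∈H₁ , coordinates-nonzero isH₂ 2∈H₂ ,
    H₁≢H₂ ∘ coordinates-injective 2∈H₁ 2∈H₂ , coordinates-∁△ H₁ H₂
  fromPG : IsPGLine (coordinates H₁) (coordinates H₂) (coordinates H₃) → IsVeldkampLine CD4 H₁ H₂ H₃
  fromPG (c₁≢0 , c₂≢0 , c₁≢c₂ , c₃≡c₁+c₂) =
    isH₁ , isH₂ , isH₃ , c₁≢c₂ ∘ cong coordinates ,
    (λ H₁≡H₃ → c₂≢0 (xor-cancelˡ _ _ (trans (cong coordinates H₁≡H₃) c₃≡c₁+c₂))) ,
    (λ H₂≡H₃ → c₁≢0 (xor-cancelʳ _ _ (trans (cong coordinates H₂≡H₃) c₃≡c₁+c₂))) ,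
    coordinates-injective 2∈H₃ (∈∁△⁺ 2∈H₁ 2∈H₂) (trans c₃≡c₁+c₂ (sym (coordinates-∁△ H₁ H₂)))

mainTheorem2 :
    HasExactly 16 (IsHyperplane CD4)
    × HasExactlyTriples 35 (IsVeldkampLine₃ CD4)
    × (Σ (Subset 5 → GF2⁴) λ f →
          (∀ H → IsHyperplane CD4 H → # 2 ∈ H → IsPGPoint (f H))
          × (∀ H H' → IsHyperplane CD4 H → # 2 ∈ H → IsHyperplane CD4 H' → # 2 ∈ H' →
               f H ≡ f H' → H ≡ H')
          × (∀ v → IsPGPoint v → ∃[ H ] (IsHyperplane CD4 H × # 2 ∈ H × f H ≡ v))
          × (∀ H₁ H₂ H₃ →
               IsHyperplane CD4 H₁ → # 2 ∈ H₁ →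
               IsHyperplane CD4 H₂ → # 2 ∈ H₂ →
               IsHyperplane CD4 H₃ → # 2 ∈ H₃ →
               IsVeldkampLine CD4 H₁ H₂ H₃ ⇔ IsPGLine (f H₁) (f H₂) (f H₃)))
    × IsHyperplane CD4 H0134
    × (∀ H → IsHyperplane CD4 H → # 2 ∉ H → H ≡ H0134)
    × (∀ H₁ H₂ H₃ → IsVeldkampLine CD4 H₁ H₂ H₃ → ¬ (H0134 ∈₃ (H₁ , H₂ , H₃)))
mainTheorem2 =
  hyperplanes-count , veldkampLines-count ,
  ( coordinates
  , (λ H isH → coordinates-nonzero isH)
  , (λ H H' _ 2∈H _ 2∈H' → coordinates-injective 2∈H 2∈H')
  , (λ v v≢0 → hyperplaneAt v , hyperplaneAt-isHyperplane v v≢0 , 2∈hyperplaneAt v , coordinates-hyperplaneAt v)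
  , (λ H₁ H₂ H₃ → veldkampLine⇔pgLine) ) ,
  H0134-isHyperplane , avoids-2⇒H0134 , (λ H₁ H₂ H₃ → veldkampLine-avoids-H0134)
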